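{- Let $V$ be a vertex set with $|V|=n\ge 2$ and let $G$ be the disjoint union of $n-1$ spanning arborescences $A_1,\dots,A_{n-1}$ on $V$, each of which is either a path or a star. Then $G$ has a rainbow spanning arborescence.
   Context: An arborescence is a connected digraph in which exactly one vertex (the root) has no incoming arc and every other vertex has exactly one incoming arc; it is spanning on $V$ if its vertex set is $V$. A leaf is a vertex with no outgoing arc. A path is an arborescence with exactly one leaf; a star is an arborescence in which every non-root vertex is a leaf. $G$ is the disjoint union of the arc sets $A_i$ (parallel arcs of different indices allowed). A subgraph $B$ of $G$ is rainbow if $|B\cap A_i|\le 1$ for all $i$. -}

module Defs where

open import Data.Nat using (ℕ; _≤_)
open import Data.Fin using (Fin; _≟_)
open import Data.Product using (Σ; _×_; _,_; proj₁; proj₂)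
open import Data.List using (List; length; filter; map)
open import Data.List.Membership.Propositional using (_∈_)
open import Relation.Binary.PropositionalEquality using (_≡_; _≢_)

-- An arc (u , v) on the vertex set V = Fin n goes from u to v.
Arc : ℕ → Set
Arc n = Fin n × Fin n

indeg : ∀ {n} → List (Arc n) → Fin n → ℕ
indeg as v = length (filter (λ a → proj₂ a ≟ v) as)

outdeg : ∀ {n} → List (Arc n) → Fin n → ℕ
outdeg as v = length (filter (λ a → proj₁ a ≟ v) as)

data UWalk {n} (as : List (Arc n)) : Fin n → Fin n → Set where
  here : ∀ {u} → UWalk as u u
  fwd  : ∀ {u v w} → (u , v) ∈ as → UWalk as v w → UWalk as u w
  bwd  : ∀ {u v w} → (v , u) ∈ as → UWalk as v w → UWalk as u w

Connected : ∀ {n} → List (Arc n) → Set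
Connected as = ∀ u v → UWalk as u v

IsRootOf : ∀ {n} → List (Arc n) → Fin n → Set
IsRootOf as r = indeg as r ≡ 0 × (∀ v → v ≢ r → indeg as v ≡ 1)

SpanningArborescence : ∀ {n} → List (Arc n) → Set
SpanningArborescence {n} as = Connected as × Σ (Fin n) (IsRootOf as)

Leaf : ∀ {n} → List (Arc n) → Fin n → Set
Leaf as v = outdeg as v ≡ 0

IsPath : ∀ {n} → List (Arc n) → Set
IsPath {n} as = Σ (Fin n) λ l → Leaf as l × (∀ v → Leaf as v → v ≡ l)

IsStar : ∀ {n} → List (Arc n) → Set
IsStar as = ∀ v → indeg as v ≢ 0 → Leaf as v

-- G = disjoint union of the A_i: a subgraph B is a list of index-tagged arcs
-- (i , a) with a ∈ A i.
SubgraphOf : ∀ {n k} → (Fin k → List (Arc n)) → List (Fin k × Arc n) → Set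
SubgraphOf A B = ∀ {i a} → (i , a) ∈ B → a ∈ A i

Rainbow : ∀ {n k} → List (Fin k × Arc n) → Set
Rainbow {k = k} B = ∀ (i : Fin k) → length (filter (λ e → proj₁ e ≟ i) B) ≤ 1

HasRainbowSpanningArborescence : ∀ {n k} → (Fin k → List (Arc n)) → Set
HasRainbowSpanningArborescence {n} {k} A =
  Σ (List (Fin k × Arc n)) λ B →
    SubgraphOf A B × Rainbow B × SpanningArborescence (map proj₂ B)

-- Take one star colour for each vertex that is the centre of some star; call these the
-- hubs and their centres c₁, …, cₜ. Each of the n − 1 − t remaining colours, a path or a
-- star centred at some cⱼ, claims its own vertex among the n − t non-centres: a path claims
-- the unclaimed non-centre that comes last along it, a star any unclaimed one. The single
-- non-centre l left over was unclaimed whenever a path chose, so it reaches, in that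
-- colour, the vertex chosen. The hubs string c₁ → ⋯ → cₜ → l into a rainbow arborescence,
-- and every vertex outside it is reachable from it in the colour that claimed it.
-- Such a configuration always grows by one vertex: send each outside vertex v to the first
-- outside vertex f v on its colour's walk from the tree; on a nonempty set of outside
-- vertices that f maps onto itself, adding one arc and passing the other colours back
-- along f restores the invariant. Repeating, the arborescence becomes spanning.

module Submission where

open import Defs
open import Data.Nat using (ℕ; _≤_; _∸_)
open import Data.Fin using (Fin)
open import Data.Product using (_×_)
open import Data.Sum using (_⊎_)
open import Data.List using (List)

open import Data.Nat using (zero; suc; _+_; _<_; z≤n; s≤s)
open import Data.Nat.Properties
  using (+-0-commutativeMonoid; +-comm; +-cancelʳ-≡; +-cancelʳ-≤; +-monoʳ-≤; +-monoˡ-≤; +-mono-≤;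
         ≤-pred; ≤-reflexive; ≤-trans; n≢0⇒n>0; suc-injective)
open import Data.Nat.Induction using (<-wellFounded)
open import Data.Fin using (zero; suc; _≟_; punchIn; punchOut)
open import Data.Fin.Properties using (punchInᵢ≢i; punchIn-punchOut)
open import Data.Product using (Σ; ∃; ∃₂; _,_; proj₁; proj₂)
open import Data.Sum as Sum using (inj₁; inj₂)
open import Data.List using ([]; _∷_; _++_; length; filter; map; allFin)
open import Data.List.Properties
  using (length-map; length-tabulate; length-++; ++-assoc; ++-identityʳ;
         filter-accept; filter-reject; filter-notAll; filter-none)
open import Data.List.Relation.Unary.Any as Any using (Any; here; there; any?)
open import Data.List.Relation.Unary.All as All using (All; []; _∷_; all?)
open import Data.List.Relation.Unary.All.Properties as All using (¬All⇒Any¬; All¬⇒¬Any)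
open import Data.List.Relation.Unary.AllPairs as AllPairs using ([]; _∷_)
open import Data.List.Relation.Unary.Unique.Propositional using (Unique)
open import Data.List.Relation.Unary.Unique.Propositional.Properties using (Unique[x∷xs]⇒x∉xs; allFin⁺)
open import Data.List.Relation.Binary.Disjoint.Propositional using (Disjoint)
open import Data.List.Relation.Binary.Permutation.Propositional
  using (_↭_; prep; swap; ↭-refl; ↭-reflexive; ↭-sym; ↭-trans; ↭⇒↭ₛ; module PermutationReasoning)
open import Data.List.Relation.Binary.Permutation.Propositional.Properties using (shift; ++⁺ˡ; ∈-resp-↭; ↭-length)
open import Data.List.Membership.Propositional using (_∈_; _∉_; find)
open import Data.List.Membership.Propositional.Properties
  using (∈-filter⁺; ∈-filter⁻; ∈-map⁺; ∈-allFin; ∈-∃++; ∈-++⁻)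
open import Algebra.Properties.CommutativeMonoid.Sum +-0-commutativeMonoid
  using (sum; sum-remove; sum-replicate-zero; sum-cong-≗)
open import Relation.Binary.Construct.Closure.ReflexiveTransitive using (Star; ε; _◅_; _◅◅_)
open import Relation.Binary.Definitions using (DecidableEquality)
open import Relation.Binary.PropositionalEquality
open import Relation.Nullary using (¬_; ¬?; yes; no; contradiction)
open import Relation.Unary using (Decidable)
open import Induction.WellFounded using (Acc; acc)
open import Function using (_∘_; id; case_of_)

private variable
  n : ℕ

module _ {A : Set} where

  open import Data.List.Relation.Binary.Permutation.Setoid.Properties (setoid A) using (Unique-resp-↭)

  ≢0⇒nonempty : {xs : List A} → length xs ≢ 0 → ∃ (_∈ xs)
  ≢0⇒nonempty {[]} len≢0 = contradiction refl len≢0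
  ≢0⇒nonempty {x ∷ _} _ = x , here refl

  ∈⇒length≢0 : {x : A} {xs : List A} → x ∈ xs → length xs ≢ 0
  ∈⇒length≢0 (here _) ()
  ∈⇒length≢0 (there _) ()

  length≤1⇒members-equal : {x y : A} {xs : List A} → length xs ≤ 1 → x ∈ xs → y ∈ xs → x ≡ y
  length≤1⇒members-equal _ (here refl) (here refl) = refl
  length≤1⇒members-equal {xs = _ ∷ []} _ (there ()) _
  length≤1⇒members-equal {xs = _ ∷ []} _ _ (there ())
  length≤1⇒members-equal {xs = _ ∷ _ ∷ _} (s≤s ()) _ _

  unique-↭ : {xs ys : List A} → xs ↭ ys → Unique ys → Unique xs
  unique-↭ xs↭ys = Unique-resp-↭ (↭⇒↭ₛ (↭-sym xs↭ys))

  unique-++⁻ : (xs : List A) {ys : List A} → Unique (xs ++ ys) → Unique xs × Unique ys × Disjoint xs ys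
  unique-++⁻ [] u = [] , u , λ ()
  unique-++⁻ (x ∷ xs) (x≢ ∷ u) with unique-++⁻ xs u
  ... | uxs , uys , disjoint = All.++⁻ˡ xs x≢ ∷ uxs , uys , λ where
    (here refl , v∈ys) → All.lookup (All.++⁻ʳ xs x≢) v∈ys refl
    (there v∈xs , v∈ys) → disjoint (v∈xs , v∈ys)

-- Sums of degrees

∑-ones : ∀ n → sum {n} (λ _ → 1) ≡ n
∑-ones zero = refl
∑-ones (suc n) = cong suc (∑-ones n)

∑-positive≥ : ∀ {n} (t : Fin n → ℕ) → (∀ i → 1 ≤ t i) → n ≤ sum t
∑-positive≥ {zero} t _ = z≤n
∑-positive≥ {suc n} t pos = +-mono-≤ (pos zero) (∑-positive≥ (λ i → t (suc i)) (λ i → pos (suc i)))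

∑-positive≤⇒≤1 : ∀ {n} (t : Fin n → ℕ) → (∀ i → 1 ≤ t i) → sum t ≤ n → ∀ i → t i ≤ 1
∑-positive≤⇒≤1 {suc n} t pos ∑≤ zero =
  +-cancelʳ-≤ n (t zero) 1 (≤-trans (+-monoʳ-≤ (t zero) (∑-positive≥ (λ i → t (suc i)) (λ i → pos (suc i)))) ∑≤)
∑-positive≤⇒≤1 {suc n} t pos ∑≤ (suc i) =
  ∑-positive≤⇒≤1 (λ i → t (suc i)) (λ i → pos (suc i)) (≤-pred (≤-trans (+-monoˡ-≤ _ (pos zero)) ∑≤)) i

∑-fibre-sizes : ∀ {A : Set} {n} (f : A → Fin n) (xs : List A) →
                sum (λ v → length (filter (λ x → f x ≟ v) xs)) ≡ length xs
∑-fibre-sizes {n = n} f [] = sum-replicate-zero n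
∑-fibre-sizes {n = zero} f (x ∷ xs) with () ← f x
∑-fibre-sizes {n = suc n} f (x ∷ xs) = begin
  sum fibre′                                                 ≡⟨ sum-remove {i = f x} fibre′ ⟩
  fibre′ (f x) + sum (λ j → fibre′ (punchIn (f x) j))        ≡⟨ cong₂ _+_ accept (sum-cong-≗ reject) ⟩
  suc (fibre (f x) + sum (λ j → fibre (punchIn (f x) j)))    ≡⟨ cong suc (sym (sum-remove fibre)) ⟩
  suc (sum fibre)                                            ≡⟨ cong suc (∑-fibre-sizes f xs) ⟩
  suc (length xs)                                            ∎
  where
  open ≡-Reasoning
  fibre fibre′ : Fin (suc n) → ℕ
  fibre v = length (filter (λ y → f y ≟ v) xs)
  fibre′ v = length (filter (λ y → f y ≟ v) (x ∷ xs))
  accept : fibre′ (f x) ≡ suc (fibre (f x))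
  accept = cong length (filter-accept (λ y → f y ≟ f x) refl)
  reject : ∀ j → fibre′ (punchIn (f x) j) ≡ fibre (punchIn (f x) j)
  reject j = cong length (filter-reject (λ y → f y ≟ punchIn (f x) j) (punchInᵢ≢i (f x) j ∘ sym))

-- Paths and stars

Reach : List (Arc n) → Fin n → Fin n → Set
Reach as = Star (λ u v → (u , v) ∈ as)

Functional : List (Arc n) → Set
Functional as = ∀ {u v w} → (u , v) ∈ as → (u , w) ∈ as → v ≡ w

Linear : List (Arc n) → Set
Linear {n} as = Functional as × Σ (Fin n) λ r → ∀ v → Reach as r v

Centred : List (Arc n) → Fin n → Set
Centred as c = ∀ v → v ≢ c → (c , v) ∈ as

last-step : ∀ {A : Set} {T : A → A → Set} {x z} → Star T x z → x ≡ z ⊎ ∃ λ y → Star T x y × T y z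
last-step ε = inj₁ refl
last-step (t ◅ p) with last-step p
... | inj₁ refl = inj₂ (_ , ε , t)
... | inj₂ (y , q , t′) = inj₂ (y , t ◅ q , t′)

module _ {as : List (Arc n)} where

  arc⇒indeg≢0 : ∀ {u v} → (u , v) ∈ as → indeg as v ≢ 0
  arc⇒indeg≢0 {v = v} e = ∈⇒length≢0 (∈-filter⁺ (λ a → proj₂ a ≟ v) e refl)

  arc⇒outdeg≢0 : ∀ {u v} → (u , v) ∈ as → outdeg as u ≢ 0
  arc⇒outdeg≢0 {u = u} e = ∈⇒length≢0 (∈-filter⁺ (λ a → proj₁ a ≟ u) e refl)

  indeg≢0⇒arc : ∀ {v} → indeg as v ≢ 0 → ∃ λ u → (u , v) ∈ as
  indeg≢0⇒arc {v} indeg≢0 with ≢0⇒nonempty {xs = filter (λ a → proj₂ a ≟ v) as} indeg≢0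
  ... | (u , _) , e∈ with ∈-filter⁻ (λ a → proj₂ a ≟ v) {xs = as} e∈
  ...   | e , refl = u , e

  indeg≤1⇒same-tail : ∀ {u w v} → indeg as v ≤ 1 → (u , v) ∈ as → (w , v) ∈ as → u ≡ w
  indeg≤1⇒same-tail {v = v} indeg≤1 e e′ =
    cong proj₁ (length≤1⇒members-equal indeg≤1 (∈-filter⁺ (λ a → proj₂ a ≟ v) e refl)
                                                (∈-filter⁺ (λ a → proj₂ a ≟ v) e′ refl))

  outdeg≤1⇒same-head : ∀ {u v w} → outdeg as u ≤ 1 → (u , v) ∈ as → (u , w) ∈ as → v ≡ w
  outdeg≤1⇒same-head {u} outdeg≤1 e e′ =
    cong proj₂ (length≤1⇒members-equal outdeg≤1 (∈-filter⁺ (λ a → proj₁ a ≟ u) e refl)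
                                                 (∈-filter⁺ (λ a → proj₁ a ≟ u) e′ refl))

  module _ {r : Fin n} (root : IsRootOf as r) where

    private
      indeg-root : indeg as r ≡ 0
      indeg-root = proj₁ root

      indeg-other : ∀ v → v ≢ r → indeg as v ≡ 1
      indeg-other = proj₂ root

      indeg-other≢0 : ∀ v → v ≢ r → indeg as v ≢ 0
      indeg-other≢0 v v≢r eq = contradiction (trans (sym eq) (indeg-other v v≢r)) λ ()

    reach-tail : ∀ {u v} → Reach as r u → (v , u) ∈ as → Reach as r v
    reach-tail {u} p e with u ≟ r
    ... | yes refl = contradiction indeg-root (arc⇒indeg≢0 e)
    ... | no u≢r with last-step p
    ...   | inj₁ r≡u = contradiction (sym r≡u) u≢r
    ...   | inj₂ (_ , q , e′) = subst (Reach as r) (indeg≤1⇒same-tail (≤-reflexive (indeg-other u u≢r)) e′ e) q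

    connected⇒root-reaches : Connected as → ∀ v → Reach as r v
    connected⇒root-reaches connected v = along (connected r v) ε
      where
      along : ∀ {u w} → UWalk as u w → Reach as r u → Reach as r w
      along here p = p
      along (fwd e walk) p = along walk (p ◅◅ e ◅ ε)
      along (bwd e walk) p = along walk (reach-tail p e)

    star⇒centred : IsStar as → Centred as r
    star⇒centred star v v≢r with indeg≢0⇒arc (indeg-other≢0 v v≢r)
    ... | u , e with u ≟ r
    ...   | yes refl = e
    ...   | no u≢r = contradiction (star u (indeg-other≢0 u u≢r)) (arc⇒outdeg≢0 e)

module _ {n : ℕ} {as : List (Arc (suc n))} {r : Fin (suc n)} (root : IsRootOf as r) where

  arc-count : length as ≡ n
  arc-count = begin
    length as                                      ≡⟨ sym (∑-fibre-sizes proj₂ as) ⟩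
    sum (indeg as)                                 ≡⟨ sum-remove {i = r} (indeg as) ⟩
    indeg as r + sum (λ j → indeg as (punchIn r j)) ≡⟨ cong₂ _+_ (proj₁ root) (sum-cong-≗ λ j → proj₂ root _ (punchInᵢ≢i r j)) ⟩
    sum {n} (λ _ → 1)                              ≡⟨ ∑-ones n ⟩
    n                                              ∎
    where open ≡-Reasoning

  -- Out-degrees sum to n, and the n vertices other than the leaf have positive out-degree.
  path⇒functional : IsPath as → Functional as
  path⇒functional (l , leaf , unique-leaf) {u} = outdeg≤1⇒same-head (outdeg≤1 u)
    where
    others : Fin n → ℕ
    others j = outdeg as (punchIn l j)

    others-positive : ∀ j → 1 ≤ others j
    others-positive j = n≢0⇒n>0 λ isLeaf → punchInᵢ≢i l j (unique-leaf _ isLeaf)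

    ∑others : sum others ≡ n
    ∑others = begin
      sum others                  ≡⟨ cong (_+ sum others) (sym leaf) ⟩
      outdeg as l + sum others    ≡⟨ sym (sum-remove {i = l} (outdeg as)) ⟩
      sum (outdeg as)             ≡⟨ ∑-fibre-sizes proj₁ as ⟩
      length as                   ≡⟨ arc-count ⟩
      n                           ∎
      where open ≡-Reasoning

    outdeg≤1 : ∀ v → outdeg as v ≤ 1
    outdeg≤1 v with l ≟ v
    ... | yes refl = subst (_≤ 1) (sym leaf) z≤n
    ... | no l≢v = subst (λ w → outdeg as w ≤ 1) (punchIn-punchOut l≢v)
                     (∑-positive≤⇒≤1 others others-positive (≤-reflexive ∑others) (punchOut l≢v))

module _ {as : List (Arc n)} (functional : Functional as) where

  comparable : ∀ {a u v} → Reach as a u → Reach as a v → Reach as u v ⊎ Reach as v u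
  comparable ε q = inj₁ q
  comparable p@(_ ◅ _) ε = inj₂ p
  comparable (e ◅ p) (e′ ◅ q) with functional e e′
  ... | refl = comparable p q

  latest : ∀ {r} → (∀ v → Reach as r v) → ∀ x xs →
           ∃ λ w → w ∈ x ∷ xs × All (λ y → Reach as y w) (x ∷ xs)
  latest reach x [] = x , here refl , ε ∷ []
  latest reach x (y ∷ ys) with latest reach y ys
  ... | w , w∈ , reach-w with comparable (reach x) (reach w)
  ...   | inj₁ x→w = w , there w∈ , x→w ∷ reach-w
  ...   | inj₂ w→x = x , here refl , ε ∷ All.map (_◅◅ w→x) reach-w

-- The exchange lemma

module Removal {A : Set} (_≟_ : DecidableEquality A) where

  opaque
    remove : A → List A → List A
    remove y = filter (λ v → ¬? (v ≟ y))

    ∈-remove⁺ : ∀ {v y xs} → v ∈ xs → v ≢ y → v ∈ remove y xs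
    ∈-remove⁺ {y = y} = ∈-filter⁺ (λ v → ¬? (v ≟ y))

    ∈-remove⁻ : ∀ {v y xs} → v ∈ remove y xs → v ∈ xs × v ≢ y
    ∈-remove⁻ {y = y} {xs} = ∈-filter⁻ (λ v → ¬? (v ≟ y)) {xs = xs}

    remove-shorter : ∀ {y xs} → y ∈ xs → length (remove y xs) < length xs
    remove-shorter {y} {xs} y∈xs =
      filter-notAll (λ v → ¬? (v ≟ y)) xs (Any.map (λ y≡v v≢y → v≢y (sym y≡v)) y∈xs)

module _ {A : Set} (_≟_ : DecidableEquality A) where
  open Removal _≟_

  Closed : (A → A) → List A → Set
  Closed f X = ∀ {x} → x ∈ X → f x ∈ X

  HasPreimage : (A → A) → List A → A → Set
  HasPreimage f X z = Any (λ u → f u ≡ z) X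

  has-preimage? : ∀ f X → Decidable (HasPreimage f X)
  has-preimage? f X z = any? (λ u → f u ≟ z) X

  record Exchange (f : A → A) (X : List A) : Set where
    field
      x₀ : A
      x₀∈X : x₀ ∈ X
      π : A → A
      π-maps : ∀ {v} → v ∈ remove (f x₀) X → π v ∈ remove x₀ X
      π-injective : ∀ {v w} → v ∈ remove (f x₀) X → w ∈ remove (f x₀) X → π v ≡ π w → v ≡ w
      π-steps-back : ∀ {v} → v ∈ remove (f x₀) X → π v ≡ v ⊎ f (π v) ≡ v

  module _ {f : A → A} {X : List A} where

    exchange-onto : ∀ {x} → x ∈ X → All (HasPreimage f X) X → Exchange f X
    exchange-onto {x} x∈X onto = record
      { x₀ = x
      ; x₀∈X = x∈X
      ; π = preimage
      ; π-maps = λ v∈ → let u∈X , fu≡v = section v∈ in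
                        ∈-remove⁺ u∈X λ u≡x → proj₂ (∈-remove⁻ v∈) (trans (sym fu≡v) (cong f u≡x))
      ; π-injective = λ v∈ w∈ eq → trans (sym (proj₂ (section v∈))) (trans (cong f eq) (proj₂ (section w∈)))
      ; π-steps-back = λ v∈ → inj₂ (proj₂ (section v∈))
      }
      where
      preimage : A → A
      preimage v with has-preimage? f X v
      ... | yes hit = proj₁ (find hit)
      ... | no _ = v

      section : ∀ {v} → v ∈ remove (f x) X → preimage v ∈ X × f (preimage v) ≡ v
      section {v} v∈ with has-preimage? f X v
      ... | yes hit = proj₂ (find hit)
      ... | no miss = contradiction (All.lookup onto (proj₁ (∈-remove⁻ v∈))) miss

    exchange-skip : ∀ {z} → z ∈ X → ¬ HasPreimage f X z → Exchange f (remove z X) → Exchange f X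
    exchange-skip {z} z∈X unhit ex = record
      { x₀ = x₀
      ; x₀∈X = proj₁ (∈-remove⁻ x₀∈X)
      ; π = π′
      ; π-maps = maps
      ; π-injective = injective
      ; π-steps-back = steps-back
      }
      where
      open Exchange ex
      π′ : A → A
      π′ v with v ≟ z
      ... | yes _ = z
      ... | no _ = π v

      shrink : ∀ {v} → v ∈ remove (f x₀) X → v ≢ z → v ∈ remove (f x₀) (remove z X)
      shrink v∈ v≢z = let v∈X , v≢fx₀ = ∈-remove⁻ v∈ in ∈-remove⁺ (∈-remove⁺ v∈X v≢z) v≢fx₀

      π≢z : ∀ {v} → v ∈ remove (f x₀) (remove z X) → π v ≢ z
      π≢z v∈ = proj₂ (∈-remove⁻ (proj₁ (∈-remove⁻ (π-maps v∈))))

      maps : ∀ {v} → v ∈ remove (f x₀) X → π′ v ∈ remove x₀ X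
      maps {v} v∈ with v ≟ z
      ... | yes _ = ∈-remove⁺ z∈X λ z≡x₀ → proj₂ (∈-remove⁻ x₀∈X) (sym z≡x₀)
      ... | no v≢z = let πv∈ , πv≢x₀ = ∈-remove⁻ (π-maps (shrink v∈ v≢z)) in
                     ∈-remove⁺ (proj₁ (∈-remove⁻ πv∈)) πv≢x₀

      injective : ∀ {v w} → v ∈ remove (f x₀) X → w ∈ remove (f x₀) X → π′ v ≡ π′ w → v ≡ w
      injective {v} {w} v∈ w∈ eq with v ≟ z | w ≟ z
      ... | yes v≡z | yes w≡z = trans v≡z (sym w≡z)
      ... | yes _ | no w≢z = contradiction (sym eq) (π≢z (shrink w∈ w≢z))
      ... | no v≢z | yes _ = contradiction eq (π≢z (shrink v∈ v≢z))
      ... | no v≢z | no w≢z = π-injective (shrink v∈ v≢z) (shrink w∈ w≢z) eq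

      steps-back : ∀ {v} → v ∈ remove (f x₀) X → π′ v ≡ v ⊎ f (π′ v) ≡ v
      steps-back {v} v∈ with v ≟ z
      ... | yes v≡z = inj₁ (sym v≡z)
      ... | no v≢z = π-steps-back (shrink v∈ v≢z)

  -- Peel off elements without preimage until f is onto what remains.
  exchange : ∀ {f} X {x} → x ∈ X → Closed f X → Exchange f X
  exchange X = go X (<-wellFounded (length X))
    where
    go : ∀ {f} X → Acc _<_ (length X) → ∀ {x} → x ∈ X → Closed f X → Exchange f X
    go {f} X (acc smaller) x∈X closed with all? (has-preimage? f X) X
    ... | yes onto = exchange-onto x∈X onto
    ... | no ¬onto with find (¬All⇒Any¬ (has-preimage? f X) X ¬onto)
    ...   | z , z∈X , unhit =
      exchange-skip z∈X unhit (go (remove z X) (smaller (remove-shorter z∈X)) fz∈X′ closed′)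
      where
      f≢z : ∀ {x} → x ∈ X → f x ≢ z
      f≢z x∈X fx≡z = unhit (Any.map (λ x≡u → trans (cong f (sym x≡u)) fx≡z) x∈X)

      fz∈X′ : f z ∈ remove z X
      fz∈X′ = ∈-remove⁺ (closed z∈X) (f≢z z∈X)

      closed′ : Closed f (remove z X)
      closed′ x∈ = let x∈X , _ = ∈-remove⁻ x∈ in ∈-remove⁺ (closed x∈X) (f≢z x∈X)

-- Growing a rainbow arborescence

crossing : ∀ {A : Set} {T : A → A → Set} {P : A → Set} → Decidable P →
           ∀ {s v} → Star T s v → ¬ P s → P v → ∃₂ λ x y → ¬ P x × P y × T x y
crossing P? ε ¬Ps Pv = contradiction Pv ¬Ps
crossing P? (_◅_ {j = y} t p) ¬Ps Pv with P? y
... | yes Py = _ , y , ¬Ps , Py , t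
... | no ¬Py = crossing P? p ¬Py Pv

module _ {as : List (Arc n)} where

  uwalk-++ : ∀ {u v w} → UWalk as u v → UWalk as v w → UWalk as u w
  uwalk-++ here q = q
  uwalk-++ (fwd e p) q = fwd e (uwalk-++ p q)
  uwalk-++ (bwd e p) q = bwd e (uwalk-++ p q)

  uwalk-reverse : ∀ {u v} → UWalk as u v → UWalk as v u
  uwalk-reverse here = here
  uwalk-reverse (fwd e p) = uwalk-++ (uwalk-reverse p) (bwd e here)
  uwalk-reverse (bwd e p) = uwalk-++ (uwalk-reverse p) (fwd e here)

  uwalk-∷ : ∀ {a u v} → UWalk as u v → UWalk (a ∷ as) u v
  uwalk-∷ here = here
  uwalk-∷ (fwd e p) = fwd (there e) (uwalk-∷ p)
  uwalk-∷ (bwd e p) = bwd (there e) (uwalk-∷ p)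

  indeg-∷-head : ∀ {u v} → indeg ((u , v) ∷ as) v ≡ suc (indeg as v)
  indeg-∷-head {v = v} = cong length (filter-accept (λ a → proj₂ a ≟ v) refl)

  indeg-∷-other : ∀ {u v w} → w ≢ v → indeg ((u , w) ∷ as) v ≡ indeg as v
  indeg-∷-other {v = v} w≢v = cong length (filter-reject (λ a → proj₂ a ≟ v) w≢v)

colours : ∀ {m} {C : Set} → List (Fin m × C) → List (Fin m)
colours = map proj₁

arcs : ∀ {n m} → List (Fin m × Arc n) → List (Arc n)
arcs = map proj₂

module _ {m : ℕ} {B : List (Fin m × Arc n)} where

  colour-count-0 : ∀ {k} → k ∉ colours B → length (filter (λ e → proj₁ e ≟ k) B) ≡ 0
  colour-count-0 k∉ = cong length (filter-none (λ e → proj₁ e ≟ _)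
    (All.tabulate λ e∈B eq → k∉ (subst (_∈ colours B) eq (∈-map⁺ proj₁ e∈B))))

  rainbow-∷ : ∀ {k a} → Rainbow B → k ∉ colours B → Rainbow ((k , a) ∷ B)
  rainbow-∷ {k} rainbow k∉ i with k ≟ i
  ... | yes refl = s≤s (≤-reflexive (colour-count-0 k∉))
  ... | no _ = rainbow i

module FinRemoval {n : ℕ} = Removal (_≟_ {n})
open FinRemoval

module Growth {n m : ℕ} (A : Fin m → List (Arc n)) where

  open import Data.List.Membership.DecPropositional (_≟_ {n}) using (_∈?_)

  -- X lists the vertices not yet spanned by the arborescence B rooted at ρ.
  record Partial (X : List (Fin n)) (B : List (Fin m × Arc n)) (ρ : Fin n) : Set where
    field
      root∉ : ρ ∉ X
      connected : ∀ {v} → v ∉ X → UWalk (arcs B) ρ v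
      indeg-root : indeg (arcs B) ρ ≡ 0
      indeg-spanned : ∀ {v} → v ∉ X → v ≢ ρ → indeg (arcs B) v ≡ 1
      indeg-pending : ∀ {v} → v ∈ X → indeg (arcs B) v ≡ 0
      subgraph : SubgraphOf A B
      rainbow : Rainbow B

  partial-root : ∀ ρ → Partial (remove ρ (allFin n)) [] ρ
  partial-root ρ = record
    { root∉ = λ ρ∈ → proj₂ (∈-remove⁻ ρ∈) refl
    ; connected = λ {v} v∉ → case v ≟ ρ of λ where
        (yes refl) → here
        (no v≢ρ) → contradiction (∈-remove⁺ (∈-allFin v) v≢ρ) v∉
    ; indeg-root = refl
    ; indeg-spanned = λ {v} v∉ v≢ρ → contradiction (∈-remove⁺ (∈-allFin v) v≢ρ) v∉
    ; indeg-pending = λ _ → refl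
    ; subgraph = λ ()
    ; rainbow = λ _ → z≤n
    }

  partial-extend : ∀ {X B ρ x y k} → Partial X B ρ → x ∉ X → y ∈ X → (x , y) ∈ A k → k ∉ colours B →
                   Partial (remove y X) ((k , (x , y)) ∷ B) ρ
  partial-extend {X} {B} {ρ} {x} {y} {k} p x∉X y∈X xy∈A k∉ = record
    { root∉ = λ ρ∈ → root∉ (proj₁ (∈-remove⁻ ρ∈))
    ; connected = connected′
    ; indeg-root = trans (indeg-∷-other y≢ρ) indeg-root
    ; indeg-spanned = indeg-spanned′
    ; indeg-pending = λ v∈ → let v∈X , v≢y = ∈-remove⁻ v∈ in
                             trans (indeg-∷-other {as = arcs B} (v≢y ∘ sym)) (indeg-pending v∈X)
    ; subgraph = λ { (here refl) → xy∈A ; (there e) → subgraph e }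
    ; rainbow = rainbow-∷ rainbow k∉
    }
    where
    open Partial p
    y≢ρ : y ≢ ρ
    y≢ρ refl = root∉ y∈X

    still-spanned : ∀ {v} → v ∉ remove y X → v ≢ y → v ∉ X
    still-spanned v∉ v≢y v∈X = v∉ (∈-remove⁺ v∈X v≢y)

    connected′ : ∀ {v} → v ∉ remove y X → UWalk (arcs ((k , (x , y)) ∷ B)) ρ v
    connected′ {v} v∉ with v ≟ y
    ... | yes refl = uwalk-++ (uwalk-∷ (connected x∉X)) (fwd (here refl) here)
    ... | no v≢y = uwalk-∷ (connected (still-spanned v∉ v≢y))

    indeg-spanned′ : ∀ {v} → v ∉ remove y X → v ≢ ρ → indeg (arcs ((k , (x , y)) ∷ B)) v ≡ 1
    indeg-spanned′ {v} v∉ v≢ρ with v ≟ y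
    ... | yes refl = trans (indeg-∷-head {as = arcs B}) (cong suc (indeg-pending y∈X))
    ... | no v≢y = trans (indeg-∷-other {as = arcs B} (v≢y ∘ sym)) (indeg-spanned (still-spanned v∉ v≢y) v≢ρ)

  partial-raise : ∀ {X B ρ ρ′ k} → Partial X B ρ → ρ′ ∈ X → (ρ′ , ρ) ∈ A k → k ∉ colours B →
                  Partial (remove ρ′ X) ((k , (ρ′ , ρ)) ∷ B) ρ′
  partial-raise {X} {B} {ρ} {ρ′} {k} p ρ′∈X arc∈A k∉ = record
    { root∉ = λ ρ′∈ → proj₂ (∈-remove⁻ ρ′∈) refl
    ; connected = connected′
    ; indeg-root = trans (indeg-∷-other {as = arcs B} ρ≢ρ′) (indeg-pending ρ′∈X)
    ; indeg-spanned = indeg-spanned′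
    ; indeg-pending = λ v∈ → let v∈X , _ = ∈-remove⁻ v∈ in
                             trans (indeg-∷-other {as = arcs B} (λ ρ≡v → root∉ (subst (_∈ X) (sym ρ≡v) v∈X)))
                                   (indeg-pending v∈X)
    ; subgraph = λ { (here refl) → arc∈A ; (there e) → subgraph e }
    ; rainbow = rainbow-∷ rainbow k∉
    }
    where
    open Partial p
    ρ≢ρ′ : ρ ≢ ρ′
    ρ≢ρ′ refl = root∉ ρ′∈X

    connected′ : ∀ {v} → v ∉ remove ρ′ X → UWalk (arcs ((k , (ρ′ , ρ)) ∷ B)) ρ′ v
    connected′ {v} v∉ with v ≟ ρ′
    ... | yes refl = here
    ... | no v≢ρ′ = fwd (here refl) (uwalk-∷ (connected (λ v∈X → v∉ (∈-remove⁺ v∈X v≢ρ′))))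

    indeg-spanned′ : ∀ {v} → v ∉ remove ρ′ X → v ≢ ρ′ → indeg (arcs ((k , (ρ′ , ρ)) ∷ B)) v ≡ 1
    indeg-spanned′ {v} v∉ v≢ρ′ with v ≟ ρ
    ... | yes refl = trans (indeg-∷-head {as = arcs B}) (cong suc indeg-root)
    ... | no v≢ρ = trans (indeg-∷-other {as = arcs B} (v≢ρ ∘ sym))
                         (indeg-spanned (λ v∈X → v∉ (∈-remove⁺ v∈X v≢ρ′)) v≢ρ)

  partial-complete : ∀ {B ρ} → Partial [] B ρ → HasRainbowSpanningArborescence A
  partial-complete {B} {ρ} p = B , subgraph , rainbow ,
    (λ u v → uwalk-++ (uwalk-reverse (connected λ ())) (connected λ ())) ,
    ρ , indeg-root , λ v → indeg-spanned λ ()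
    where open Partial p

  record Owners (X : List (Fin n)) (B : List (Fin m × Arc n)) (own : Fin n → Fin m) : Set where
    field
      unused : ∀ {v} → v ∈ X → own v ∉ colours B
      injective : ∀ {v w} → v ∈ X → w ∈ X → own v ≡ own w → v ≡ w
      reachable : ∀ {v} → v ∈ X → ∃ λ s → s ∉ X × Reach (A (own v)) s v

  record Configuration (X : List (Fin n)) : Set where
    field
      B : List (Fin m × Arc n)
      ρ : Fin n
      own : Fin n → Fin m
      partial : Partial X B ρ
      owners : Owners X B own

  -- Each pending v is entered from the spanned part by an arc of its own colour, ending at
  -- exit-head v ∈ X. The exchange lemma picks the arc to add and hands every other colour
  -- on to a vertex it still reaches, possibly now in one step.
  grow : ∀ {X x} → x ∈ X → Configuration X → ∃ λ y → y ∈ X × Configuration (remove y X)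
  grow {X} x∈X c = y₀ , y₀∈X , record
    { B = (own x₀ , exit x₀) ∷ B
    ; ρ = ρ
    ; own = own ∘ π
    ; partial = partial-extend partial tail∉X y₀∈X arc∈A (unused x₀∈X)
    ; owners = record { unused = unused′ ; injective = injective′ ; reachable = reachable′ }
    }
    where
    open Configuration c
    open Owners owners

    exit-at : ∀ {v} → v ∈ X → ∃₂ λ a b → a ∉ X × b ∈ X × (a , b) ∈ A (own v)
    exit-at v∈X = let s , s∉X , path = reachable v∈X in crossing (_∈? X) path s∉X v∈X

    exit : Fin n → Arc n
    exit v with v ∈? X
    ... | yes v∈X = proj₁ (exit-at v∈X) , proj₁ (proj₂ (exit-at v∈X))
    ... | no _ = v , v

    exit-spec : ∀ {v} → v ∈ X → proj₁ (exit v) ∉ X × proj₂ (exit v) ∈ X × exit v ∈ A (own v)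
    exit-spec {v} v∈X with v ∈? X
    ... | yes v∈X′ = proj₂ (proj₂ (exit-at v∈X′))
    ... | no v∉X = contradiction v∈X v∉X

    exit-head : Fin n → Fin n
    exit-head v = proj₂ (exit v)

    open Exchange (exchange _≟_ {f = exit-head} X x∈X (proj₁ ∘ proj₂ ∘ exit-spec))

    y₀ : Fin n
    y₀ = exit-head x₀

    tail∉X : proj₁ (exit x₀) ∉ X
    tail∉X = proj₁ (exit-spec x₀∈X)

    y₀∈X : y₀ ∈ X
    y₀∈X = proj₁ (proj₂ (exit-spec x₀∈X))

    arc∈A : exit x₀ ∈ A (own x₀)
    arc∈A = proj₂ (proj₂ (exit-spec x₀∈X))

    π∈X : ∀ {v} → v ∈ remove y₀ X → π v ∈ X
    π∈X = proj₁ ∘ ∈-remove⁻ ∘ π-maps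

    unused′ : ∀ {v} → v ∈ remove y₀ X → own (π v) ∉ colours ((own x₀ , exit x₀) ∷ B)
    unused′ v∈ (here eq) = proj₂ (∈-remove⁻ (π-maps v∈)) (injective (π∈X v∈) x₀∈X eq)
    unused′ v∈ (there k∈) = unused (π∈X v∈) k∈

    injective′ : ∀ {v w} → v ∈ remove y₀ X → w ∈ remove y₀ X → own (π v) ≡ own (π w) → v ≡ w
    injective′ v∈ w∈ eq = π-injective v∈ w∈ (injective (π∈X v∈) (π∈X w∈) eq)

    reachable′ : ∀ {v} → v ∈ remove y₀ X → ∃ λ s → s ∉ remove y₀ X × Reach (A (own (π v))) s v
    reachable′ v∈ with π-steps-back v∈
    ... | inj₁ πv≡v = let s , s∉X , path = reachable (π∈X v∈) in
                      s , s∉X ∘ proj₁ ∘ ∈-remove⁻ , subst (Reach _ s) πv≡v path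
    ... | inj₂ exit≡v = let tail∉X , _ , arc = exit-spec (π∈X v∈) in
                        _ , tail∉X ∘ proj₁ ∘ ∈-remove⁻ , subst (Reach _ _) exit≡v (arc ◅ ε)

  augment : ∀ {X} → Configuration X → HasRainbowSpanningArborescence A
  augment {X} = go X (<-wellFounded (length X))
    where
    go : ∀ X → Acc _<_ (length X) → Configuration X → HasRainbowSpanningArborescence A
    go [] _ c = partial-complete (Configuration.partial c)
    go (x ∷ X) (acc smaller) c with grow (here refl) c
    ... | y , y∈ , c′ = go (remove y (x ∷ X)) (smaller (remove-shorter y∈)) c′

-- The initial configuration

module PathsAndStars {n k : ℕ} (A : Fin (suc k) → List (Arc n)) where

  open Growth A
  open import Data.List.Membership.DecPropositional (_≟_ {n}) using (_∈?_)

  Hub : Set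
  Hub = Fin (suc k) × Fin n

  centres : List Hub → List (Fin n)
  centres = map proj₂

  HubCentred : Hub → Set
  HubCentred (i , c) = Centred (A i) c

  Attached : List Hub → Fin (suc k) → Set
  Attached hubs d = Linear (A d) ⊎ ∃ λ c → c ∈ centres hubs × Centred (A d) c

  -- The hubs are one star colour for each centre that occurs; the free vertices are the non-centres.
  record Split (ks : List (Fin (suc k))) : Set where
    field
      hubs : List Hub
      others : List (Fin (suc k))
      free : List (Fin n)
      colours↭ : colours hubs ++ others ↭ ks
      vertices↭ : free ++ centres hubs ↭ allFin n
      hubs-centred : All HubCentred hubs
      others-attached : All (Attached hubs) others

  module _ {ks} (s : Split ks) where
    open Split s

    split-other : ∀ {i} → Attached hubs i → Split (i ∷ ks)
    split-other {i} attached = record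
      { hubs = hubs
      ; others = i ∷ others
      ; free = free
      ; colours↭ = ↭-trans (shift i (colours hubs) others) (prep i colours↭)
      ; vertices↭ = vertices↭
      ; hubs-centred = hubs-centred
      ; others-attached = attached ∷ others-attached
      }

    split-hub : ∀ {i c} → Centred (A i) c → c ∈ free → Split (i ∷ ks)
    split-hub {i} {c} centred c∈ with ys , zs , free≡ ← ∈-∃++ c∈ = record
      { hubs = (i , c) ∷ hubs
      ; others = others
      ; free = ys ++ zs
      ; colours↭ = prep i colours↭
      ; vertices↭ = ↭-trans moved (subst (λ F → F ++ centres hubs ↭ allFin n) free≡ vertices↭)
      ; hubs-centred = centred ∷ hubs-centred
      ; others-attached = All.map weaken others-attached
      }
      where
      moved : (ys ++ zs) ++ c ∷ centres hubs ↭ (ys ++ c ∷ zs) ++ centres hubs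
      moved = begin
        (ys ++ zs) ++ c ∷ centres hubs   ≡⟨ ++-assoc ys zs _ ⟩
        ys ++ zs ++ c ∷ centres hubs     ↭⟨ ++⁺ˡ ys (shift c zs _) ⟩
        ys ++ c ∷ zs ++ centres hubs     ≡⟨ ++-assoc ys (c ∷ zs) _ ⟨
        (ys ++ c ∷ zs) ++ centres hubs   ∎
        where open PermutationReasoning

      weaken : ∀ {d} → Attached hubs d → Attached ((i , c) ∷ hubs) d
      weaken (inj₁ linear) = inj₁ linear
      weaken (inj₂ (c′ , c′∈ , centred′)) = inj₂ (c′ , there c′∈ , centred′)

    non-free⇒centre : ∀ {c} → c ∉ free → c ∈ centres hubs
    non-free⇒centre c∉ with ∈-++⁻ free (∈-resp-↭ (↭-sym vertices↭) (∈-allFin _))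
    ... | inj₁ c∈ = contradiction c∈ c∉
    ... | inj₂ c∈ = c∈

  split : (∀ i → Linear (A i) ⊎ ∃ (Centred (A i))) → ∀ ks → Split ks
  split kind [] = record
    { hubs = []
    ; others = []
    ; free = allFin n
    ; colours↭ = ↭-refl
    ; vertices↭ = ↭-reflexive (++-identityʳ _)
    ; hubs-centred = []
    ; others-attached = []
    }
  split kind (i ∷ ks) with split kind ks | kind i
  ... | s | inj₁ linear = split-other s (inj₁ linear)
  ... | s | inj₂ (c , centred) with c ∈? Split.free s
  ...   | yes c∈ = split-hub s centred c∈
  ...   | no c∉ = split-other s (inj₂ (c , non-free⇒centre s c∉ , centred))

  module _ (hubs : List Hub) where

    record Assignment (D : List (Fin (suc k))) (X : List (Fin n)) : Set where
      field
        survivor : Fin n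
        assigned : List (Fin n)
        partition : survivor ∷ assigned ↭ X
        owner : Fin n → Fin (suc k)
        owner∈ : ∀ {v} → v ∈ assigned → owner v ∈ D
        owner-injective : ∀ {v w} → v ∈ assigned → w ∈ assigned → owner v ≡ owner w → v ≡ w
        owner-reaches : ∀ {v} → v ∈ assigned →
                        ∃ λ s → s ∈ survivor ∷ centres hubs × Reach (A (owner v)) s v

    Reached : Fin (suc k) → List (Fin n) → Fin n → Set
    Reached d X w = (∀ {s} → s ∈ X → Reach (A d) s w) ⊎ ∃ λ c → c ∈ centres hubs × Reach (A d) c w

    -- A linear colour takes the free vertex that comes last along it, so that whichever
    -- vertex survives reaches it; a star colour takes any free vertex.
    pick : ∀ {d x xs} → Attached hubs d → x ∉ centres hubs →
           ∃ λ w → w ∈ x ∷ xs × (All (λ s → Reach (A d) s w) (x ∷ xs) ⊎ ∃ λ c → c ∈ centres hubs × Reach (A d) c w)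
    pick {x = x} {xs} (inj₁ (functional , _ , reach)) _ =
      let w , w∈ , reach-w = latest functional reach x xs in w , w∈ , inj₁ reach-w
    pick {x = x} (inj₂ (c , c∈ , centred)) x∉ =
      x , here refl , inj₂ (c , c∈ , centred x (λ x≡c → x∉ (subst (_∈ centres hubs) (sym x≡c) c∈)) ◅ ε)

    assignment-∷ : ∀ {d D ys w zs} → d ∉ D → w ∉ ys ++ zs → Reached d (ys ++ zs) w →
                   Assignment D (ys ++ zs) → Assignment (d ∷ D) (ys ++ w ∷ zs)
    assignment-∷ {d} {D} {ys} {w} {zs} d∉D w∉ reached a = record
      { survivor = survivor
      ; assigned = w ∷ assigned
      ; partition = ↭-trans (swap survivor w ↭-refl) (↭-trans (prep w partition) (↭-sym (shift w ys zs)))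
      ; owner = owner′
      ; owner∈ = owner∈′
      ; owner-injective = injective′
      ; owner-reaches = reaches′
      }
      where
      open Assignment a

      owner′ : Fin n → Fin (suc k)
      owner′ v with v ≟ w
      ... | yes _ = d
      ... | no _ = owner v

      owner′-new : owner′ w ≡ d
      owner′-new with w ≟ w
      ... | yes _ = refl
      ... | no w≢w = contradiction refl w≢w

      owner′-old : ∀ {v} → v ∈ assigned → owner′ v ≡ owner v
      owner′-old {v} v∈ with v ≟ w
      ... | yes refl = contradiction (∈-resp-↭ partition (there v∈)) w∉
      ... | no _ = refl

      owner′-old∈ : ∀ {v} → v ∈ assigned → owner′ v ∈ D
      owner′-old∈ v∈ = subst (_∈ D) (sym (owner′-old v∈)) (owner∈ v∈)

      owner∈′ : ∀ {v} → v ∈ w ∷ assigned → owner′ v ∈ d ∷ D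
      owner∈′ (here refl) = here owner′-new
      owner∈′ (there v∈) = there (owner′-old∈ v∈)

      injective′ : ∀ {u v} → u ∈ w ∷ assigned → v ∈ w ∷ assigned → owner′ u ≡ owner′ v → u ≡ v
      injective′ (here refl) (here refl) _ = refl
      injective′ (here refl) (there v∈) eq = contradiction (subst (_∈ D) (trans (sym eq) owner′-new) (owner′-old∈ v∈)) d∉D
      injective′ (there u∈) (here refl) eq = contradiction (subst (_∈ D) (trans eq owner′-new) (owner′-old∈ u∈)) d∉D
      injective′ (there u∈) (there v∈) eq = owner-injective u∈ v∈ (trans (sym (owner′-old u∈)) (trans eq (owner′-old v∈)))

      reaches-new : ∃ λ s → s ∈ survivor ∷ centres hubs × Reach (A d) s w
      reaches-new = Sum.[ (λ from-free → survivor , here refl , from-free (∈-resp-↭ partition (here refl)))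
                        , (λ (c , c∈ , path) → c , there c∈ , path) ]′ reached

      reaches′ : ∀ {v} → v ∈ w ∷ assigned → ∃ λ s → s ∈ survivor ∷ centres hubs × Reach (A (owner′ v)) s v
      reaches′ (here refl) = let s , s∈ , path = reaches-new in
                             s , s∈ , subst (λ i → Reach (A i) s w) (sym owner′-new) path
      reaches′ (there v∈) = let s , s∈ , path = owner-reaches v∈ in
                            s , s∈ , subst (λ i → Reach (A i) s _) (sym (owner′-old v∈)) path

    assign : ∀ D X → length X ≡ suc (length D) → Unique D → Unique X → All (Attached hubs) D →
             (∀ {v} → v ∈ X → v ∉ centres hubs) → Assignment D X
    assign [] (l ∷ []) _ _ _ _ _ = record
      { survivor = l
      ; assigned = []
      ; partition = ↭-refl
      ; owner = λ _ → zero -- arbitrary, as nothing is assigned; hence colours Fin (suc k)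
      ; owner∈ = λ ()
      ; owner-injective = λ ()
      ; owner-reaches = λ ()
      }
    assign (d ∷ D) (x ∷ xs) len (d∉ ∷ uD) uX (attached ∷ attached*) non-centre
      with w , w∈ , reached ← pick {xs = xs} attached (non-centre (here refl))
      with ys , zs , X≡ ← ∈-∃++ w∈
      = subst (Assignment (d ∷ D)) (sym X≡)
          (assignment-∷ (All¬⇒¬Any d∉) (Unique[x∷xs]⇒x∉xs uW) reached′ (assign D (ys ++ zs) len′ uD (AllPairs.tail uW) attached* non-centre′))
      where
      rest⊆ : ∀ {s} → s ∈ ys ++ zs → s ∈ x ∷ xs
      rest⊆ s∈ = subst (_ ∈_) (sym X≡) (∈-resp-↭ (↭-sym (shift w ys zs)) (there s∈))

      uW : Unique (w ∷ ys ++ zs)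
      uW = unique-↭ (↭-sym (shift w ys zs)) (subst Unique X≡ uX)

      len′ : length (ys ++ zs) ≡ suc (length D)
      len′ = suc-injective (trans (sym (↭-length (shift w ys zs))) (trans (cong length (sym X≡)) len))

      reached′ : Reached d (ys ++ zs) w
      reached′ = Sum.map₁ (λ reach-w s∈ → All.lookup reach-w (rest⊆ s∈)) reached

      non-centre′ : ∀ {v} → v ∈ ys ++ zs → v ∉ centres hubs
      non-centre′ = non-centre ∘ rest⊆

  -- The path c₁ → ⋯ → cₜ → l through the hub centres, the arc out of cⱼ coloured by its hub.
  record Chain (l : Fin n) (hubs : List Hub) : Set where
    field
      pending : List (Fin n)
      tree : List (Fin (suc k) × Arc n)
      root : Fin n
      partial : Partial pending tree root
      pending⁺ : ∀ {v} → v ∉ l ∷ centres hubs → v ∈ pending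
      pending⁻ : ∀ {v} → v ∈ pending → v ∉ l ∷ centres hubs
      colours≡ : colours tree ≡ colours hubs

  chain : ∀ l hubs → All HubCentred hubs → Unique (colours hubs) → Unique (l ∷ centres hubs) → Chain l hubs
  chain l [] _ _ _ = record
    { pending = remove l (allFin n)
    ; tree = []
    ; root = l
    ; partial = partial-root l
    ; pending⁺ = λ v∉ → ∈-remove⁺ (∈-allFin _) (v∉ ∘ here)
    ; pending⁻ = λ { v∈ (here v≡l) → proj₂ (∈-remove⁻ v∈) v≡l }
    ; colours≡ = refl
    }
  chain l ((i , c) ∷ hubs) (centred ∷ centred*) (i∉ ∷ uI) ((l∉ ∷ l∉*) ∷ c∉ ∷ uC) = record
    { pending = remove c pending
    ; tree = (i , (c , root)) ∷ tree
    ; root = c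
    ; partial = partial-raise partial c∈ (centred root root≢c) (subst (i ∉_) (sym colours≡) (All¬⇒¬Any i∉))
    ; pending⁺ = λ v∉ → ∈-remove⁺ (pending⁺ (v∉ ∘ skip-c)) (v∉ ∘ there ∘ here)
    ; pending⁻ = pending⁻′
    ; colours≡ = cong (i ∷_) colours≡
    }
    where
    open Chain (chain l hubs centred* uI (l∉* ∷ uC))

    skip-c : ∀ {v} → v ∈ l ∷ centres hubs → v ∈ l ∷ c ∷ centres hubs
    skip-c (here v≡l) = here v≡l
    skip-c (there v∈) = there (there v∈)

    c∈ : c ∈ pending
    c∈ = pending⁺ λ where
      (here c≡l) → l∉ (sym c≡l)
      (there c∈C) → All¬⇒¬Any c∉ c∈C

    root≢c : root ≢ c
    root≢c refl = Partial.root∉ partial c∈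

    pending⁻′ : ∀ {v} → v ∈ remove c pending → v ∉ l ∷ c ∷ centres hubs
    pending⁻′ v∈ (here v≡l) = pending⁻ (proj₁ (∈-remove⁻ v∈)) (here v≡l)
    pending⁻′ v∈ (there (here v≡c)) = proj₂ (∈-remove⁻ v∈) v≡c
    pending⁻′ v∈ (there (there v∈C)) = pending⁻ (proj₁ (∈-remove⁻ v∈)) (there v∈C)

rainbow-arborescence : ∀ {k} (A : Fin (suc k) → List (Arc (suc (suc k)))) →
                       (∀ i → Linear (A i) ⊎ ∃ (Centred (A i))) → HasRainbowSpanningArborescence A
rainbow-arborescence {k} A kind =
  augment (record { B = tree ; ρ = root ; own = owner ; partial = partial ; owners = owners })
  where
  open Growth A
  open PathsAndStars A
  open Split (split kind (allFin (suc k)))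

  colour-parts : Unique (colours hubs) × Unique others × Disjoint (colours hubs) others
  colour-parts = unique-++⁻ (colours hubs) (unique-↭ colours↭ (allFin⁺ _))

  vertex-parts : Unique free × Unique (centres hubs) × Disjoint free (centres hubs)
  vertex-parts = unique-++⁻ free (unique-↭ vertices↭ (allFin⁺ _))

  free⇒non-centre : ∀ {v} → v ∈ free → v ∉ centres hubs
  free⇒non-centre v∈ c∈ = proj₂ (proj₂ vertex-parts) (v∈ , c∈)

  free-count : length free ≡ suc (length others)
  free-count = +-cancelʳ-≡ (length hubs) _ _ (begin
    length free + length hubs                  ≡⟨ cong (length free +_) (sym (length-map proj₂ hubs)) ⟩
    length free + length (centres hubs)        ≡⟨ sym (length-++ free) ⟩
    length (free ++ centres hubs)              ≡⟨ ↭-length vertices↭ ⟩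
    length (allFin (suc (suc k)))              ≡⟨ length-tabulate id ⟩
    suc (suc k)                                ≡⟨ cong suc (sym (length-tabulate id)) ⟩
    suc (length (allFin (suc k)))              ≡⟨ cong suc (sym (↭-length colours↭)) ⟩
    suc (length (colours hubs ++ others))      ≡⟨ cong suc (length-++ (colours hubs)) ⟩
    suc (length (colours hubs) + length others) ≡⟨ cong suc (+-comm _ (length others)) ⟩
    suc (length others + length (colours hubs)) ≡⟨ cong (λ h → suc (length others + h)) (length-map proj₁ hubs) ⟩
    suc (length others) + length hubs          ∎)
    where open ≡-Reasoning

  open Assignment (assign hubs others free free-count (proj₁ (proj₂ colour-parts)) (proj₁ vertex-parts)
                          others-attached free⇒non-centre)

  survivor∈free : survivor ∈ free
  survivor∈free = ∈-resp-↭ partition (here refl)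

  open Chain (chain survivor hubs hubs-centred (proj₁ colour-parts)
                    (All.tabulate (λ c∈ survivor≡c → free⇒non-centre survivor∈free (subst (_∈ _) (sym survivor≡c) c∈))
                     ∷ proj₁ (proj₂ vertex-parts)))

  pending⇒assigned : ∀ {v} → v ∈ pending → v ∈ assigned
  pending⇒assigned v∈ with ∈-++⁻ free (∈-resp-↭ (↭-sym vertices↭) (∈-allFin _))
  ... | inj₂ v∈C = contradiction (there v∈C) (pending⁻ v∈)
  ... | inj₁ v∈free with ∈-resp-↭ (↭-sym partition) v∈free
  ...   | here v≡survivor = contradiction (here v≡survivor) (pending⁻ v∈)
  ...   | there v∈assigned = v∈assigned

  owners : Owners pending tree owner
  owners = record
    { unused = λ {v} v∈ i∈ → proj₂ (proj₂ colour-parts) (subst (owner v ∈_) colours≡ i∈ , owner∈ (pending⇒assigned v∈))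
    ; injective = λ v∈ w∈ → owner-injective (pending⇒assigned v∈) (pending⇒assigned w∈)
    ; reachable = λ v∈ → let s , s∈ , path = owner-reaches (pending⇒assigned v∈) in
                         s , (λ s∈pending → pending⁻ s∈pending s∈) , path
    }

classify : ∀ {n} {as : List (Arc (suc n))} → SpanningArborescence as × (IsPath as ⊎ IsStar as) →
           Linear as ⊎ ∃ (Centred as)
classify ((connected , r , root) , inj₁ path) =
  inj₁ (path⇒functional root path , r , connected⇒root-reaches root connected)
classify ((_ , r , root) , inj₂ star) = inj₂ (r , star⇒centred root star)

corollary3p4 : (n : ℕ) → 2 ≤ n → (A : Fin (n ∸ 1) → List (Arc n)) →
    (∀ i → SpanningArborescence (A i) × (IsPath (A i) ⊎ IsStar (A i))) →
    HasRainbowSpanningArborescence A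
corollary3p4 (suc zero) (s≤s ()) _ _
corollary3p4 (suc (suc k)) _ A hyp = rainbow-arborescence A (classify ∘ hyp)
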